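{- Let $T$ be an $spo(2m,n)$-tableau and let $x,x'\in B_0\cup B_1$ such that $x'\geq x$ if $x,x'\in B_1$, and $x'>x$ otherwise. Suppose that $T\leftarrow x'$ has one more box $B'$ than $T$ and that $(T\leftarrow x')\leftarrow x$ has one more box $B$ than $T\leftarrow x'$. Then $B$ lies strictly below $B'$.
   Context: Fix positive integers $m,n$. Let $B_0=\{1,\overline{1},\dots,m,\overline{m}\}$ and $B_1=\{1^\circ,\dots,n^\circ\}$, totally ordered by $1<\overline{1}<2<\overline{2}<\cdots<m<\overline{m}<1^\circ<\cdots<n^\circ$. Young diagrams are drawn with row $1$ on top. An $spo(2m,n)$-tableau of shape $\lambda$ is a filling of the Young diagram of $\lambda$ with entries of $B_0\cup B_1$ such that the boxes with entries in $B_0$ form a Young diagram of a shape $\mu\subseteq\lambda$ on which entries weakly increase along rows, strictly increase down columns, and every entry in row $i$ is $\geq i$ (no $j$ or $\overline{j}$ with $j<i$ in row $i$); and the entries of $B_1$ in $\lambda/\mu$ strictly increase along rows and weakly increase down columns. Forward slide: for a filling with one empty box, with $x$ the entry immediately to its right and $y$ the entry immediately below; if only one exists it moves in; otherwise $x$ moves left if $x<y$ or $x=y\in B_1$, and $y$ moves up if $y<x$ or $x=y\in B_0$. Repeat until the empty box is at an outer corner, and delete that box. $spo$-insertion $T\leftarrow x$: insert $z=x$ into row 1; to insert $z$ into row $r$: if $z\in B_0$ and $z\geq$ all entries of row $r$, or $z\in B_1$ and $z>$ all entries of row $r$ (including an empty row below the tableau), append $z$ at the end of row $r$ and stop; otherwise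 let $z'$ be the leftmost entry of row $r$ with $z'\geq z$ (if $z\in B_1$) or with $z'>z$ (if $z\in B_0$), replace $z'$ by $z$ and insert $z'$ into row $r+1$. If at some stage an $i\in\{1,\dots,m\}$ inserted into row $i$ would bump an $\overline{i}$ out of row $i$ (a cancellation), then at the first such stage the $\overline{i}$ is removed instead (and $i$ not placed) and forward slides move the empty box to an outer corner, where it is deleted. Thus $T\leftarrow x$ has one box more or one box fewer than $T$. -}

module Defs where

open import Data.Nat using (ℕ; zero; suc; _+_; _*_; _≤_; _<_; _≤ᵇ_; _<ᵇ_; _≡ᵇ_)
open import Data.Fin using (Fin; toℕ)
open import Data.Bool using (Bool; true; false; if_then_else_; _∧_; _∨_)
open import Data.List using (List; []; _∷_; length; map)
open import Data.Nat.ListAction using (sum)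
open import Data.Maybe using (Maybe; just; nothing)
open import Data.Product using (_×_; _,_)
open import Data.Empty using (⊥)
open import Data.Unit using (⊤)
open import Relation.Binary.PropositionalEquality using (_≡_; _≢_)

-- The alphabet B₀ ∪ B₁.
-- Indices are 0-based: unb i is the letter (toℕ i + 1), bar i is its
-- barred version, cir j is the letter (toℕ j + 1)°.

data Letter (m n : ℕ) : Set where
  unb : Fin m → Letter m n
  bar : Fin m → Letter m n
  cir : Fin n → Letter m n

module _ {m n : ℕ} where

  -- position in the total order 1 < 1̄ < 2 < 2̄ < ... < m < m̄ < 1° < ... < n°
  rank : Letter m n → ℕ
  rank (unb i) = 2 * toℕ i
  rank (bar i) = suc (2 * toℕ i)
  rank (cir j) = 2 * m + toℕ j

  _≺_ : Letter m n → Letter m n → Set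
  a ≺ b = rank a < rank b

  _≼_ : Letter m n → Letter m n → Set
  a ≼ b = rank a ≤ rank b

  isB1 : Letter m n → Bool
  isB1 (cir _) = true
  isB1 _       = false

  InB0 : Letter m n → Set
  InB0 (cir _) = ⊥
  InB0 _       = ⊤

  InB1 : Letter m n → Set
  InB1 (cir _) = ⊤
  InB1 _       = ⊥

  -- the number j (1-based) of a letter j or j̄ of B₀ ; unused on B₁
  -- "row r (0-based) may contain a B₀-letter a only if r + 1 ≤ index a"
  RowOK : ℕ → Letter m n → Set
  RowOK r (unb i) = r ≤ toℕ i
  RowOK r (bar i) = r ≤ toℕ i
  RowOK r (cir _) = ⊤

-- Tableaux: list of rows, row 1 first.

Tab : ℕ → ℕ → Set
Tab m n = List (List (Letter m n))

at : {A : Set} → List A → ℕ → Maybe A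
at []       _       = nothing
at (a ∷ as) zero    = just a
at (a ∷ as) (suc k) = at as k

rowAt : {A : Set} → List (List A) → ℕ → List A
rowAt []       _       = []
rowAt (w ∷ ws) zero    = w
rowAt (w ∷ ws) (suc k) = rowAt ws k

rowLen : {A : Set} → List (List A) → ℕ → ℕ
rowLen T r = length (rowAt T r)

entry : {A : Set} → List (List A) → ℕ → ℕ → Maybe A
entry T r c = at (rowAt T r) c

size : {A : Set} → List (List A) → ℕ
size T = sum (map length T)

-- B₀-entries form a subdiagram μ (in each row they
-- form a prefix, and a box below a B₁-box is a B₁-box); on μ rows weakly
-- increase, columns strictly increase, and row i contains no j, j̄ with
-- j < i; on λ/μ rows strictly increase and columns weakly increase.

record IsSpoTableau {m n : ℕ} (T : Tab m n) : Set where
  field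
    rowsNonEmpty : ∀ r → r < length T → 0 < rowLen T r
    shapeDecr    : ∀ r → rowLen T (suc r) ≤ rowLen T r
    horiz : ∀ r c a b → entry T r c ≡ just a → entry T r (suc c) ≡ just b →
              (InB0 a → InB0 b → a ≼ b) ×
              (InB1 a → InB1 b → a ≺ b) ×
              (InB1 a → InB1 b)
    vert  : ∀ r c a b → entry T r c ≡ just a → entry T (suc r) c ≡ just b →
              (InB0 a → InB0 b → a ≺ b) ×
              (InB1 a → InB1 b → a ≼ b) ×
              (InB1 a → InB1 b)
    rowCond : ∀ r c a → entry T r c ≡ just a → RowOK r a

module _ {m n : ℕ} where

  bumps : Letter m n → Letter m n → Bool
  bumps z z' = if isB1 z then rank z ≤ᵇ rank z' else rank z <ᵇ rank z'

  data RowRes : Set where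
    appended : List (Letter m n) → RowRes
    bumped   : ℕ → Letter m n → List (Letter m n) → RowRes
      -- column of bumped entry, bumped entry, new row

  shiftRes : Letter m n → RowRes → RowRes
  shiftRes a (appended w)   = appended (a ∷ w)
  shiftRes a (bumped c b w) = bumped (suc c) b (a ∷ w)

  scan : Letter m n → List (Letter m n) → RowRes
  scan z []      = appended (z ∷ [])
  scan z (a ∷ w) = if bumps z a then bumped 0 a (z ∷ w) else shiftRes a (scan z w)

  -- cancellation: i inserted into row i (1-based r) bumps ī
  cancels : ℕ → Letter m n → Letter m n → Bool
  cancels r (unb i) (bar j) = (toℕ i ≡ᵇ toℕ j) ∧ (r ≡ᵇ suc (toℕ i))
  cancels _ _ _ = false

  data InsRes : Set where
    grown : Tab m n → InsRes
    hole  : Tab m n → ℕ → ℕ → InsRes   -- filling with empty box at (row, col), 0-based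

  consRow : List (Letter m n) → InsRes → InsRes
  consRow w (grown T)    = grown (w ∷ T)
  consRow w (hole T r c) = hole (w ∷ T) (suc r) c

  -- insert z into row r (1-based) = head of the given list of rows
  ins : ℕ → Letter m n → Tab m n → InsRes
  ins r z []       = grown ((z ∷ []) ∷ [])
  ins r z (w ∷ ws) with scan z w
  ... | appended w'    = grown (w' ∷ ws)
  ... | bumped c z' w' =
        if cancels r z z' then hole (w ∷ ws) 0 c
        else consRow w' (ins (suc r) z' ws)

  setAt : {A : Set} → List A → ℕ → A → List A
  setAt []       _       _ = []
  setAt (a ∷ as) zero    x = x ∷ as
  setAt (a ∷ as) (suc k) x = a ∷ setAt as k x

  removeAt : {A : Set} → List A → ℕ → List A
  removeAt []       _       = []
  removeAt (a ∷ as) zero    = as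
  removeAt (a ∷ as) (suc k) = a ∷ removeAt as k

  setE : Tab m n → ℕ → ℕ → Letter m n → Tab m n
  setE []       _       c x = []
  setE (w ∷ ws) zero    c x = setAt w c x ∷ ws
  setE (w ∷ ws) (suc r) c x = w ∷ setE ws r c x

  dropEmpty : Tab m n → Tab m n
  dropEmpty []             = []
  dropEmpty ([] ∷ ws)      = dropEmpty ws
  dropEmpty ((a ∷ w) ∷ ws) = (a ∷ w) ∷ dropEmpty ws

  delBox : Tab m n → ℕ → ℕ → Tab m n
  delBox []       _       c = []
  delBox (w ∷ ws) zero    c = dropEmpty (removeAt w c ∷ ws)
  delBox (w ∷ ws) (suc r) c = dropEmpty (w ∷ delBox ws r c)

  -- x (right neighbour) moves left iff x < y or x = y ∈ B₁;
  -- otherwise (y < x or x = y ∈ B₀) y (lower neighbour) moves up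
  moveLeft : Letter m n → Letter m n → Bool
  moveLeft x y = (rank x <ᵇ rank y) ∨ ((rank x ≡ᵇ rank y) ∧ isB1 x)

  -- forward slides of the empty box at (r , c), with fuel; the content
  -- stored at the empty position is irrelevant (never read)
  slide : ℕ → Tab m n → ℕ → ℕ → Tab m n
  slide zero    T r c = T
  slide (suc k) T r c with entry T r (suc c) | entry T (suc r) c
  ... | nothing | nothing = delBox T r c
  ... | just x  | nothing = slide k (setE T r c x) r (suc c)
  ... | nothing | just y  = slide k (setE T r c y) (suc r) c
  ... | just x  | just y  =
        if moveLeft x y then slide k (setE T r c x) r (suc c)
        else slide k (setE T r c y) (suc r) c

  finishIns : InsRes → Tab m n
  finishIns (grown T)    = T
  finishIns (hole T r c) = slide (suc (size T)) T r c

  _⇐_ : Tab m n → Letter m n → Tab m n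
  T ⇐ x = finishIns (ins 1 x T)

AddsBox : {A : Set} → List (List A) → List (List A) → ℕ × ℕ → Set
AddsBox T U (r , c) =
  (c ≡ rowLen T r) × (rowLen U r ≡ suc c) × (∀ k → k ≢ r → rowLen U k ≡ rowLen T k)

InsOrder : {m n : ℕ} → Letter m n → Letter m n → Set
InsOrder x@(cir _) x'@(cir _) = x ≼ x'
InsOrder x x' = x ≺ x'

-- An insertion that meets a cancellation only moves entries and then
-- deletes a box, so it never adds one; hence both insertions are plain row insertions.
-- Compare them row by row. If x′ is appended to a row, x bumps in that row (at the latest
-- it bumps x′). If x′ bumps y′, then x bumps some y that again precedes y′ in the
-- bumping order: either y = x′, or y is a letter that x′ passed over. So the bumping route
-- of x continues strictly beyond the row where x′ stopped.

module Submission where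

open import Defs
open import Data.Nat using (ℕ; zero; suc; _+_; _*_; _≤_; _<_; z≤n; s≤s; z<s)
open import Data.Nat.Properties
open import Data.Fin using (Fin; toℕ)
open import Data.Fin.Properties using (toℕ<n)
open import Data.Bool using (true; false; T)
open import Data.Bool.Properties using (T-≡)
open import Data.Empty using (⊥-elim)
open import Data.List using (List; []; _∷_; length)
open import Data.Maybe using (Maybe; just; nothing)
open import Data.Maybe.Relation.Unary.All as Maybe using (just; nothing)
open import Data.Product using (Σ; ∃; _×_; _,_; proj₁)
open import Function.Bundles using (Equivalence)
open import Relation.Binary.PropositionalEquality

adds-box-in-head : ∀ {A : Set} (T U : List (List A)) {r c} →
                   rowLen U 0 ≡ suc (rowLen T 0) → AddsBox T U (r , c) → r ≡ 0
adds-box-in-head T U {r = zero}  _     _               = refl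
adds-box-in-head T U {r = suc _} grows (_ , _ , other) =
  ⊥-elim (1+n≢n (trans (sym grows) (other 0 λ ())))

adds-box-in-tail : ∀ {A : Set} (u v : List A) us vs {r c} → length v ≡ length u →
                   AddsBox (u ∷ us) (v ∷ vs) (r , c) → ∃ λ k → r ≡ suc k × AddsBox us vs (k , c)
adds-box-in-tail u v us vs {r = zero}  same (c≡ , grows , _) =
  ⊥-elim (1+n≢n (trans (sym (trans grows (cong suc c≡))) same))
adds-box-in-tail u v us vs {r = suc k} _    (c≡ , grows , other) =
  k , refl , c≡ , grows , λ j j≢k → other (suc j) (λ e → j≢k (suc-injective e))

size-cong : ∀ {A : Set} (T U : List (List A)) → (∀ k → rowLen U k ≡ rowLen T k) → size U ≡ size T
size-cong []       []       _    = refl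
size-cong (t ∷ ts) []       same = cong₂ _+_ (same 0) (size-cong ts [] (λ k → same (suc k)))
size-cong []       (u ∷ us) same = cong₂ _+_ (same 0) (size-cong [] us (λ k → same (suc k)))
size-cong (t ∷ ts) (u ∷ us) same = cong₂ _+_ (same 0) (size-cong ts us (λ k → same (suc k)))

size-grow : ∀ {A : Set} (T U : List (List A)) r → rowLen U r ≡ suc (rowLen T r) →
            (∀ k → k ≢ r → rowLen U k ≡ rowLen T k) → size U ≡ suc (size T)
size-grow T        []       r       () _
size-grow []       (u ∷ us) zero    grows other = cong₂ _+_ grows (size-cong [] us (λ k → other (suc k) λ ()))
size-grow (t ∷ ts) (u ∷ us) zero    grows other = cong₂ _+_ grows (size-cong ts us (λ k → other (suc k) λ ()))
size-grow []       (u ∷ us) (suc r) grows other =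
  cong₂ _+_ (other 0 λ ()) (size-grow [] us r grows (λ k k≢r → other (suc k) (λ e → k≢r (suc-injective e))))
size-grow (t ∷ ts) (u ∷ us) (suc r) grows other = begin
  length u + size us       ≡⟨ cong₂ _+_ (other 0 λ ()) (size-grow ts us r grows (λ k k≢r → other (suc k) (λ e → k≢r (suc-injective e)))) ⟩
  length t + suc (size ts) ≡⟨ +-suc (length t) (size ts) ⟩
  suc (size (t ∷ ts))      ∎
  where open ≡-Reasoning

size-addsBox : ∀ {A : Set} (T U : List (List A)) r c → AddsBox T U (r , c) → size U ≡ suc (size T)
size-addsBox T U r c (c≡ , grows , other) = size-grow T U r (trans grows (cong suc c≡)) other

module _ {m n : ℕ} where

  T-true : ∀ {b} → b ≡ true → T b
  T-true = Equivalence.from T-≡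

  bar≺cir : ∀ (i : Fin m) (j : Fin n) → bar {m} {n} i ≺ cir j
  bar≺cir i j = <-≤-trans (subst (_≤ 2 * m) (*-suc 2 (toℕ i)) (*-monoʳ-≤ 2 (toℕ<n i)))
                          (m≤m+n (2 * m) (toℕ j))

  ≺⇒InsOrder : ∀ (a b : Letter m n) → a ≺ b → InsOrder a b
  ≺⇒InsOrder (cir _) (cir _) a≺b = <⇒≤ a≺b
  ≺⇒InsOrder (cir _) (unb _) a≺b = a≺b
  ≺⇒InsOrder (cir _) (bar _) a≺b = a≺b
  ≺⇒InsOrder (unb _) b       a≺b = a≺b
  ≺⇒InsOrder (bar _) b       a≺b = a≺b

  InsOrder⇒bumps : ∀ (z y : Letter m n) → InsOrder z y → bumps z y ≡ true
  InsOrder⇒bumps (cir _) (cir _) z≼y = Equivalence.to T-≡ (≤⇒≤ᵇ z≼y)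
  InsOrder⇒bumps (cir _) (unb _) z≺y = Equivalence.to T-≡ (≤⇒≤ᵇ (<⇒≤ z≺y))
  InsOrder⇒bumps (cir _) (bar _) z≺y = Equivalence.to T-≡ (≤⇒≤ᵇ (<⇒≤ z≺y))
  InsOrder⇒bumps (unb _) y       z≺y = Equivalence.to T-≡ (<⇒<ᵇ z≺y)
  InsOrder⇒bumps (bar _) y       z≺y = Equivalence.to T-≡ (<⇒<ᵇ z≺y)

  bumps⇒InsOrder : ∀ (z y : Letter m n) → bumps z y ≡ true → InsOrder z y
  bumps⇒InsOrder (cir _) (cir _) e = ≤ᵇ⇒≤ _ _ (T-true e)
  bumps⇒InsOrder (cir j) (unb i) e =
    ⊥-elim (<⇒≱ (≤-trans (n≤1+n _) (bar≺cir i j)) (≤ᵇ⇒≤ _ _ (T-true e)))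
  bumps⇒InsOrder (cir j) (bar i) e =
    ⊥-elim (<⇒≱ (bar≺cir i j) (≤ᵇ⇒≤ _ _ (T-true e)))
  bumps⇒InsOrder (unb _) y       e = <ᵇ⇒< _ _ (T-true e)
  bumps⇒InsOrder (bar _) y       e = <ᵇ⇒< _ _ (T-true e)

  skipped≺bumped : ∀ (z a y : Letter m n) → bumps z a ≡ false → bumps z y ≡ true → a ≺ y
  skipped≺bumped (cir j) a y skip bump =
    <-≤-trans (≰⇒> (λ z≤a → subst T skip (≤⇒≤ᵇ z≤a))) (≤ᵇ⇒≤ (rank {m} (cir j)) (rank y) (T-true bump))
  skipped≺bumped (unb _) a y skip bump =
    ≤-<-trans (≮⇒≥ (λ z<a → subst T skip (<⇒<ᵇ z<a))) (<ᵇ⇒< _ _ (T-true bump))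
  skipped≺bumped (bar _) a y skip bump =
    ≤-<-trans (≮⇒≥ (λ z<a → subst T skip (<⇒<ᵇ z<a))) (<ᵇ⇒< _ _ (T-true bump))

  newRow : RowRes {m} {n} → List (Letter m n)
  newRow (appended w)   = w
  newRow (bumped _ _ w) = w

  ejected : RowRes {m} {n} → Maybe (Letter m n)
  ejected (appended _)   = nothing
  ejected (bumped _ y _) = just y

  newRow-shiftRes : ∀ a r → newRow (shiftRes a r) ≡ a ∷ newRow r
  newRow-shiftRes a (appended _)   = refl
  newRow-shiftRes a (bumped _ _ _) = refl

  ejected-shiftRes : ∀ a r → ejected (shiftRes a r) ≡ ejected r
  ejected-shiftRes a (appended _)   = refl
  ejected-shiftRes a (bumped _ _ _) = refl

  growth : RowRes {m} {n} → ℕ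
  growth (appended _)   = 1
  growth (bumped _ _ _) = 0

  growth-shiftRes : ∀ a r → growth (shiftRes a r) ≡ growth r
  growth-shiftRes a (appended _)   = refl
  growth-shiftRes a (bumped _ _ _) = refl

  length-scan : ∀ (z : Letter m n) w → length (newRow (scan z w)) ≡ growth (scan z w) + length w
  length-scan z [] = refl
  length-scan z (a ∷ w) with bumps z a
  ... | true  = refl
  ... | false rewrite newRow-shiftRes a (scan z w) | growth-shiftRes a (scan z w) =
    trans (cong suc (length-scan z w)) (sym (+-suc _ (length w)))

  length-scan-appended : ∀ (z : Letter m n) w {w′} →
                         scan z w ≡ appended w′ → length w′ ≡ suc (length w)
  length-scan-appended z w eq =
    subst (λ r → length (newRow r) ≡ growth r + length w) eq (length-scan z w)

  length-scan-bumped : ∀ (z : Letter m n) w {c y w′} →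
                       scan z w ≡ bumped c y w′ → length w′ ≡ length w
  length-scan-bumped z w eq =
    subst (λ r → length (newRow r) ≡ growth r + length w) eq (length-scan z w)

  ejected-is-bumped : ∀ (z : Letter m n) w →
                      Maybe.All (λ y → bumps z y ≡ true) (ejected (scan z w))
  ejected-is-bumped z [] = nothing
  ejected-is-bumped z (a ∷ w) with bumps z a in z-bumps-a
  ... | true  = just z-bumps-a
  ... | false rewrite ejected-shiftRes a (scan z w) = ejected-is-bumped z w

  BumpsAfter : RowRes {m} {n} → RowRes {m} {n} → Set
  BumpsAfter second first =
    Σ (Letter m n) λ y → ejected second ≡ just y × Maybe.All (InsOrder y) (ejected first)

  scan-twice : ∀ {z z′ : Letter m n} → InsOrder z z′ → ∀ w →
               BumpsAfter (scan z (newRow (scan z′ w))) (scan z′ w)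
  scan-twice {z} {z′} z<z′ [] rewrite InsOrder⇒bumps z z′ z<z′ = z′ , refl , nothing
  scan-twice {z} {z′} z<z′ (a ∷ w) with bumps z′ a in z′-bumps-a
  ... | true rewrite InsOrder⇒bumps z z′ z<z′ = z′ , refl , just (bumps⇒InsOrder z′ a z′-bumps-a)
  ... | false rewrite newRow-shiftRes a (scan z′ w) | ejected-shiftRes a (scan z′ w) with bumps z a
  ...   | true  = a , refl , Maybe.map a-precedes (ejected-is-bumped z′ w)
    where
    a-precedes : ∀ {y} → bumps z′ y ≡ true → InsOrder a y
    a-precedes {y} z′-bumps-y = ≺⇒InsOrder a y (skipped≺bumped z′ a y z′-bumps-a z′-bumps-y)
  ...   | false rewrite ejected-shiftRes a (scan z (newRow (scan z′ w))) = scan-twice z<z′ w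

  row-bumping : ∀ {z z′ : Letter m n} → InsOrder z z′ → ∀ w {r₁ r₂} →
                scan z′ w ≡ r₁ → scan z (newRow r₁) ≡ r₂ → BumpsAfter r₂ r₁
  row-bumping z<z′ w refl refl = scan-twice z<z′ w

  data GrownStep (r : ℕ) (z : Letter m n) (w : List (Letter m n)) (ws : Tab m n) :
                 Tab m n → Set where
    appendsTo : ∀ {w′} → scan z w ≡ appended w′ → GrownStep r z w ws (w′ ∷ ws)
    bumpsDown : ∀ {c y w′ U} → scan z w ≡ bumped c y w′ → ins (suc r) y ws ≡ grown U →
                GrownStep r z w ws (w′ ∷ U)

  grown-step : ∀ r z w ws {U} → ins r z (w ∷ ws) ≡ grown U → GrownStep r z w ws U
  grown-step r z w ws e with scan z w in sc
  ... | appended w′ with refl ← e = appendsTo sc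
  ... | bumped c y w′ with cancels r z y
  ...   | true with () ← e
  ...   | false with ins (suc r) y ws in e′
  ...     | grown U with refl ← e = bumpsDown sc e′
  ...     | hole _ _ _ with () ← e

  second-box-below : ∀ {z z′ : Letter m n} → InsOrder z z′ → ∀ r T {T₁ T₂} →
                     ins r z′ T ≡ grown T₁ → ins r z T₁ ≡ grown T₂ →
                     ∀ {r′ c′ k c} → AddsBox T T₁ (r′ , c′) → AddsBox T₁ T₂ (k , c) → r′ < k
  second-box-below {z} {z′} z<z′ r [] refl e₂ a₁ a₂ with grown-step r z (z′ ∷ []) [] e₂
  ... | appendsTo sc₂ with () ← row-bumping z<z′ [] refl sc₂
  ... | bumpsDown {w′ = w₂} {U = T₂′} sc₂ _
    with refl ← adds-box-in-head [] ((z′ ∷ []) ∷ []) refl a₁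
       | adds-box-in-tail (z′ ∷ []) w₂ [] T₂′ (length-scan-bumped z (z′ ∷ []) sc₂) a₂
  ...   | _ , refl , _ = z<s
  second-box-below {z} {z′} z<z′ r (w ∷ ws) e₁ e₂ a₁ a₂ with grown-step r z′ w ws e₁
  ... | appendsTo {w′ = w₁} sc₁ with grown-step r z w₁ ws e₂
  ...   | appendsTo sc₂ with () ← row-bumping z<z′ w sc₁ sc₂
  ...   | bumpsDown {w′ = w₂} {U = T₂′} sc₂ _
    with refl ← adds-box-in-head (w ∷ ws) (w₁ ∷ ws) (length-scan-appended z′ w sc₁) a₁
       | adds-box-in-tail w₁ w₂ ws T₂′ (length-scan-bumped z w₁ sc₂) a₂
  ...     | _ , refl , _ = z<s
  second-box-below {z} {z′} z<z′ r (w ∷ ws) e₁ e₂ a₁ a₂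
    | bumpsDown {w′ = w₁} {U = T₁′} sc₁ e₁′ with grown-step r z w₁ T₁′ e₂
  ...   | appendsTo sc₂ with () ← row-bumping z<z′ w sc₁ sc₂
  ...   | bumpsDown {w′ = w₂} {U = T₂′} sc₂ e₂′
    with row-bumping z<z′ w sc₁ sc₂
       | adds-box-in-tail w w₁ ws T₁′ (length-scan-bumped z′ w sc₁) a₁
       | adds-box-in-tail w₁ w₂ T₁′ T₂′ (length-scan-bumped z w₁ sc₂) a₂
  ...     | _ , refl , just y<y′ | _ , refl , a₁′ | _ , refl , a₂′ =
    s≤s (second-box-below y<y′ (suc r) ws e₁′ e₂′ a₁′ a₂′)

  size-ins-hole : ∀ r (z : Letter m n) T {S a b} → ins r z T ≡ hole S a b → size S ≡ size T
  size-ins-hole r z [] ()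
  size-ins-hole r z (w ∷ ws) e with scan z w in sc
  ... | appended _ with () ← e
  ... | bumped c y w′ with cancels r z y
  ...   | true with refl ← e = refl
  ...   | false with ins (suc r) y ws in e′
  ...     | grown _ with () ← e
  ...     | hole S a b with refl ← e =
    cong₂ _+_ (length-scan-bumped z w sc) (size-ins-hole (suc r) y ws e′)

  length-setAt : ∀ (w : List (Letter m n)) c x → length (setAt {m} {n} w c x) ≡ length w
  length-setAt []      c       x = refl
  length-setAt (a ∷ w) zero    x = refl
  length-setAt (a ∷ w) (suc c) x = cong suc (length-setAt w c x)

  size-setE : ∀ (T : Tab m n) r c x → size (setE T r c x) ≡ size T
  size-setE []       r       c x = refl
  size-setE (w ∷ ws) zero    c x = cong (_+ size ws) (length-setAt w c x)
  size-setE (w ∷ ws) (suc r) c x = cong (length w +_) (size-setE ws r c x)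

  length-removeAt : ∀ (w : List (Letter m n)) c → length (removeAt {m} {n} w c) ≤ length w
  length-removeAt []      c       = z≤n
  length-removeAt (a ∷ w) zero    = n≤1+n _
  length-removeAt (a ∷ w) (suc c) = s≤s (length-removeAt w c)

  size-dropEmpty : ∀ (T : Tab m n) → size (dropEmpty T) ≡ size T
  size-dropEmpty []             = refl
  size-dropEmpty ([] ∷ ws)      = size-dropEmpty ws
  size-dropEmpty ((a ∷ w) ∷ ws) = cong (suc (length w) +_) (size-dropEmpty ws)

  size-delBox : ∀ (T : Tab m n) r c → size (delBox T r c) ≤ size T
  size-delBox []       r       c = z≤n
  size-delBox (w ∷ ws) zero    c = begin
    size (dropEmpty (removeAt {m} {n} w c ∷ ws)) ≡⟨ size-dropEmpty (removeAt {m} {n} w c ∷ ws) ⟩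
    length (removeAt {m} {n} w c) + size ws      ≤⟨ +-monoˡ-≤ (size ws) (length-removeAt w c) ⟩
    length w + size ws                           ∎
    where open ≤-Reasoning
  size-delBox (w ∷ ws) (suc r) c = begin
    size (dropEmpty (w ∷ delBox ws r c)) ≡⟨ size-dropEmpty (w ∷ delBox ws r c) ⟩
    length w + size (delBox ws r c)      ≤⟨ +-monoʳ-≤ (length w) (size-delBox ws r c) ⟩
    length w + size ws                   ∎
    where open ≤-Reasoning

  size-slide : ∀ k (T : Tab m n) r c → size (slide k T r c) ≤ size T
  size-slide zero    T r c = ≤-refl
  size-slide (suc k) T r c with entry T r (suc c) | entry T (suc r) c
  ... | nothing | nothing = size-delBox T r c
  ... | just x  | nothing = ≤-trans (size-slide k _ r (suc c)) (≤-reflexive (size-setE T r c x))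
  ... | nothing | just y  = ≤-trans (size-slide k _ (suc r) c) (≤-reflexive (size-setE T r c y))
  ... | just x  | just y with moveLeft x y
  ...   | true  = ≤-trans (size-slide k _ r (suc c)) (≤-reflexive (size-setE T r c x))
  ...   | false = ≤-trans (size-slide k _ (suc r) c) (≤-reflexive (size-setE T r c y))

  grown-of-adds-box : ∀ r (z : Letter m n) T {k c} → AddsBox T (finishIns (ins r z T)) (k , c) →
                      ins r z T ≡ grown (finishIns (ins r z T))
  grown-of-adds-box r z T {k} {c} adds with ins r z T in e
  ... | grown _    = refl
  ... | hole S a b = ⊥-elim (<-irrefl refl (begin-strict
    size T                            <⟨ n<1+n (size T) ⟩
    suc (size T)                      ≡⟨ size-addsBox T (slide (suc (size S)) S a b) k c adds ⟨
    size (slide (suc (size S)) S a b) ≤⟨ size-slide (suc (size S)) S a b ⟩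
    size S                            ≡⟨ size-ins-hole r z T e ⟩
    size T                            ∎))
    where open ≤-Reasoning

lemma5p2 : (m n : ℕ) (T : Tab m n) → IsSpoTableau T →
    (x x' : Letter m n) → InsOrder x x' →
    (B' B : ℕ × ℕ) →
    AddsBox T (T ⇐ x') B' →
    AddsBox (T ⇐ x') ((T ⇐ x') ⇐ x) B →
    proj₁ B' < proj₁ B
lemma5p2 m n T _ x x' x<x' (_ , _) (_ , _) adds' adds =
  second-box-below x<x' 1 T (grown-of-adds-box 1 x' T adds') (grown-of-adds-box 1 x (T ⇐ x') adds)
                   adds' adds
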